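{- Let $A\in\mathcal A_n$, let $T=\tau(A)$ and fix an integer $g\ge 0$. Then $\operatorname{gldim}(A)\le g$ if and only if there are no two siblings $i<j$ in $T$ such that the subtree rooted at $i$ has depth at least $\lfloor g/2\rfloor$ and the subtree rooted at $j$ has depth at least $\lceil g/2\rceil$.
   Context: $K$ is an algebraically closed field. A connected linear Nakayama algebra with $m$ simple modules is $KQ/I$ with $Q$ the linear quiver $0\to1\to\cdots\to m-1$ and $I$ an admissible ideal; its Kupisch series $[c_0,\dots,c_{m-1}]$, $c_i=\dim_K e_iA$, satisfies $c_{i+1}+1\ge c_i\ge 2$ for $0\le i<m-1$ and $c_{m-1}=1$. $\mathcal A_n$ denotes the set of ordered products $A=A_1\times\cdots\times A_k$ ($k\ge1$; order matters) of connected linear Nakayama algebras with $n$ simple modules in total, with Kupisch series $[c_0,\dots,c_{n-1}]$ the concatenation of those of the factors; $\operatorname{gldim}(A)=\max_j\operatorname{gldim}(A_j)$. $\tau(A)$ is the rooted tree with vertex set $\{0,\dots,n\}$, root $n$, in which the parent of $i$ ($0\le i<n$) is $i+c_i$. Siblings are distinct vertices with the same parent; "$i<j$" compares labels. The depth of the subtree rooted at a vertex $v$ is the maximal number of edges on a path from $v$ down to a descendant of $v$. -}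

module Defs where

open import Data.Nat using (ℕ; zero; suc; _+_; _∸_; _≤_; _<_; ⌊_/2⌋; ⌈_/2⌉)
open import Data.Vec using (Vec; []; _∷_)
open import Data.Product using (Σ; _×_; ∃)
open import Relation.Binary.PropositionalEquality using (_≡_)

-- Entry i of a Kupisch series (0 outside the range 0..n-1; never used there).
at : {n : ℕ} → Vec ℕ n → ℕ → ℕ
at []       _       = 0
at (x ∷ xs) zero    = x
at (x ∷ xs) (suc i) = at xs i

-- [c_0,...,c_{n-1}] is the (concatenated) Kupisch series of some A ∈ 𝒜_n:
-- n ≥ 1, c_{n-1} = 1, every c_i ≥ 1 and c_i ≤ c_{i+1} + 1.
-- (Factors are exactly the maximal blocks ending at an entry equal to 1;
-- inside a factor the non-last entries are ≥ 2.)
record IsKupisch {n : ℕ} (c : Vec ℕ n) : Set where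
  field
    nonempty : 1 ≤ n
    last     : at c (n ∸ 1) ≡ 1
    pos      : ∀ i → i < n → 1 ≤ at c i
    step     : ∀ i → suc i < n → at c i ≤ suc (at c (suc i))

-- Indecomposable modules of a linear Nakayama algebra: M(i,l) = e_i A / e_i A rad^l,
-- 1 ≤ l ≤ c_i, with composition factors S_i,...,S_{i+l-1}.  Its projective cover
-- is e_i A = M(i,c_i), and for l < c_i its syzygy is M(i+l, c_i - l).
-- PdLe c i l k  :≡  pd M(i,l) ≤ k.
data PdLe (c : ℕ → ℕ) : ℕ → ℕ → ℕ → Set where
  proj : ∀ {i l k} → l ≡ c i → PdLe c i l k
  syz  : ∀ {i l k} → l < c i → PdLe c (i + l) (c i ∸ l) k → PdLe c i l (suc k)

-- gldim A ≤ g : every simple module S_i = M(i,1) has projective dimension ≤ g.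
GldimLe : {n : ℕ} → Vec ℕ n → ℕ → Set
GldimLe {n} c g = ∀ i → i < n → PdLe (at c) i 1 g

-- The tree τ(A): vertices 0..n, root n, parent of i < n is i + c_i.
parent : {n : ℕ} → Vec ℕ n → ℕ → ℕ
parent c i = i + at c i

data Path {n : ℕ} (c : Vec ℕ n) : ℕ → ℕ → ℕ → Set where
  here  : ∀ {v} → v ≤ n → Path c v v 0
  there : ∀ {w v d} → w < n → Path c (parent c w) v d → Path c w v (suc d)

DepthGe : {n : ℕ} → Vec ℕ n → ℕ → ℕ → Set
DepthGe c v d = Σ ℕ λ w → Σ ℕ λ e → d ≤ e × Path c w v e

SiblingsLt : {n : ℕ} → Vec ℕ n → ℕ → ℕ → Set
SiblingsLt {n} c i j = i < j × j < n × parent c i ≡ parent c j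

BadPair : {n : ℕ} → Vec ℕ n → ℕ → Set
BadPair c g = Σ ℕ λ i → Σ ℕ λ j →
  SiblingsLt c i j × DepthGe c i ⌊ g /2⌋ × DepthGe c j ⌈ g /2⌉

module Submission where

open import Defs
open import Data.Nat
  using (ℕ; zero; suc; _+_; _∸_; _≤_; _<_; _≤′_; ≤′-refl; ≤′-step; z≤n; s≤s; ⌊_/2⌋; ⌈_/2⌉)
open import Data.Nat.Properties
open import Data.Nat.GeneralisedArithmetic using (iterate)
open import Data.Vec using (Vec; []; _∷_)
open import Data.Product using (∃-syntax; _×_; _,_)
open import Data.Sum using (_⊎_; inj₁; inj₂)
import Data.Sum as Sum
open import Function.Base using (_∘_)
open import Function.Bundles using (_⇔_; mk⇔; Equivalence)
open import Relation.Binary.Core using (_Preserves_⟶_)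
open import Relation.Binary.Definitions using (tri<; tri≈; tri>)
open import Relation.Nullary using (¬_; yes; no)
open import Relation.Nullary.Negation using (contradiction)
open import Relation.Binary.PropositionalEquality
  using (_≡_; refl; sym; trans; cong; subst; subst₂)

-- Write M(y, z ∸ y) as the interval [y, z); its syzygy is [z, P y), where P is the parent
-- map of τ(A).  The syzygies of S_i thus have endpoints i, i + 1, P i, P (i + 1), P² i, …,
-- alternating between the ancestor paths of i and i + 1, and pd S_i > g exactly when the
-- first g + 2 steps of this sequence are strict.  Following such a sequence until the two
-- ancestor paths meet produces siblings of depths at least ⌊g/2⌋ and ⌈g/2⌉.  Conversely,
-- given siblings u < v and descendants a of u and b of v at those depths, a discrete
-- intermediate value argument finds the i between a and b at which the relevant iterate
-- of P jumps over v; the sequence of S_i is then strict up to step g + 2, the last step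
-- because P u = P v.

crossing : (h : ℕ → ℕ) {t a b : ℕ} → a ≤ b → h a < t → t ≤ h b →
           ∃[ i ] a ≤ i × i < b × h i < t × t ≤ h (suc i)
crossing h {b = zero} z≤n ha<t t≤hb = contradiction (<-≤-trans ha<t t≤hb) (<-irrefl refl)
crossing h {t} {b = suc b} z≤n ha<t t≤hb with t ≤? h b
... | no t≰hb = b , z≤n , ≤-refl , ≰⇒> t≰hb , t≤hb
... | yes t≤hb′ with crossing h z≤n ha<t t≤hb′
...   | i , _ , i<b , rest = i , z≤n , m<n⇒m<1+n i<b , rest
crossing h (s≤s a≤b) ha<t t≤hb with crossing (h ∘ suc) a≤b ha<t t≤hb
... | i , a≤i , i<b , rest = suc i , s≤s a≤i , s≤s i<b , rest

even⊎odd : ∀ g → (∃[ m ] g ≡ m + m) ⊎ (∃[ m ] g ≡ suc (m + m))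
even⊎odd zero = inj₁ (0 , refl)
even⊎odd (suc g) with even⊎odd g
... | inj₁ (m , refl) = inj₂ (m , refl)
... | inj₂ (m , refl) = inj₁ (suc m , cong suc (sym (+-suc m m)))

module _ {f : ℕ → ℕ} where

  iterate-suc : ∀ x m → iterate f x (suc m) ≡ f (iterate f x m)
  iterate-suc x zero    = refl
  iterate-suc x (suc m) = iterate-suc (f x) m

  iterate-inflationary : (∀ x → x ≤ f x) → ∀ x m → x ≤ iterate f x m
  iterate-inflationary infl x zero    = ≤-refl
  iterate-inflationary infl x (suc m) = ≤-trans (infl x) (iterate-inflationary infl (f x) m)

  module _ (mono : f Preserves _≤_ ⟶ _≤_) where

    iterate-mono : ∀ m {x y} → x ≤ y → iterate f x m ≤ iterate f y m
    iterate-mono zero    x≤y = x≤y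
    iterate-mono (suc m) x≤y = iterate-mono m (mono x≤y)

    iterate-cancel-< : ∀ m {x y} → iterate f x m < iterate f y m → x < y
    iterate-cancel-< m lt = ≰⇒> (λ y≤x → <⇒≱ lt (iterate-mono m y≤x))

at-beyond : ∀ {n} (c : Vec ℕ n) {x} → n ≤ x → at c x ≡ 0
at-beyond []      _         = refl
at-beyond (_ ∷ c) (s≤s n≤x) = at-beyond c n≤x

module Nakayama {n : ℕ} (c : Vec ℕ n) where

  P : ℕ → ℕ
  P = parent c

  P-inflationary : ∀ x → x ≤ P x
  P-inflationary x = m≤m+n x (at c x)

  P-beyond : ∀ {x} → n ≤ x → P x ≡ x
  P-beyond {x} n≤x = trans (cong (x +_) (at-beyond c n≤x)) (+-identityʳ x)

  <P⇒<n : ∀ {x} → x < P x → x < n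
  <P⇒<n {x} x<Px with x <? n
  ... | yes x<n = x<n
  ... | no  x≮n = contradiction (P-beyond (≮⇒≥ x≮n)) (<⇒≢ x<Px ∘ sym)

  Path⇒iterate : ∀ {w v d} → Path c w v d → iterate P w d ≡ v
  Path⇒iterate (here _)    = refl
  Path⇒iterate (there _ p) = Path⇒iterate p

  Path-drop : ∀ k {w v d} → Path c w v (k + d) → ∃[ w′ ] Path c w′ v d
  Path-drop zero    p           = _ , p
  Path-drop (suc k) (there _ p) = Path-drop k p

  descendantAt : ∀ {v d} → DepthGe c v d → ∃[ w ] iterate P w d ≡ v
  descendantAt {v} {d} (w , e , d≤e , p)
    with Path-drop (e ∸ d) (subst (Path c w v) (sym (m∸n+n≡m d≤e)) p)
  ... | w′ , p′ = w′ , Path⇒iterate p′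

  DepthGe-zero : ∀ {v} → v ≤ n → DepthGe c v 0
  DepthGe-zero {v} v≤n = v , 0 , z≤n , here v≤n

  DepthGe-≤ : ∀ {v d e} → d ≤ e → DepthGe c v e → DepthGe c v d
  DepthGe-≤ d≤e (w , f , e≤f , p) = w , f , ≤-trans d≤e e≤f , p

  BadPair-antitone : ∀ {g h} → g ≤ h → BadPair c h → BadPair c g
  BadPair-antitone g≤h (i , j , sib , di , dj) =
    i , j , sib , DepthGe-≤ (⌊n/2⌋-mono g≤h) di , DepthGe-≤ (⌈n/2⌉-mono g≤h) dj

  -- PdGt y z k: the module [y, z) = M(y, z ∸ y) and its first k syzygies are not projective.
  PdGt : ℕ → ℕ → ℕ → Set
  PdGt y z zero    = z < P y
  PdGt y z (suc k) = z < P y × PdGt z (P y) k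

  PdGt⇒<P : ∀ k {y z} → PdGt y z k → z < P y
  PdGt⇒<P zero    z<Py       = z<Py
  PdGt⇒<P (suc k) (z<Py , _) = z<Py

  syzygy-end : ∀ y {l} → l ≤ at c y → y + l + (at c y ∸ l) ≡ P y
  syzygy-end y l≤cy = trans (+-assoc y _ _) (cong (y +_) (m+[n∸m]≡n l≤cy))

  pdGt⇒¬pdLe : ∀ k {y l} → PdGt y (y + l) k → ¬ PdLe (at c) y l k
  pdGt⇒¬pdLe k {y} pd (proj l≡cy) = <⇒≢ (PdGt⇒<P k pd) (cong (y +_) l≡cy)
  pdGt⇒¬pdLe (suc k) {y} {l} (_ , pd) (syz l<cy pd′) =
    pdGt⇒¬pdLe k (subst (λ z → PdGt (y + l) z k) (sym (syzygy-end y (<⇒≤ l<cy))) pd) pd′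

  module _ (K : IsKupisch c) where
    open IsKupisch K

    <n⇒<P : ∀ {x} → x < n → x < P x
    <n⇒<P {x} x<n = m<m+n x (pos x x<n)

    P-suc : ∀ x → P x ≤ P (suc x)
    P-suc x with <-cmp (suc x) n
    ... | tri< 1+x<n _ _ = ≤-trans (+-monoʳ-≤ x (step x 1+x<n)) (≤-reflexive (+-suc x _))
    ... | tri≈ _ 1+x≡n _ = ≤-trans (≤-reflexive Px≡1+x) (P-inflationary (suc x))
      where
        Px≡1+x : P x ≡ suc x
        Px≡1+x = trans (cong (x +_) cx≡1) (+-comm x 1)
          where
            cx≡1 : at c x ≡ 1
            cx≡1 = subst (λ m → at c (m ∸ 1) ≡ 1) (sym 1+x≡n) last
    ... | tri> _ _ n<1+x = ≤-trans (≤-reflexive (P-beyond (≤-pred n<1+x)))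
                                   (≤-trans (n≤1+n x) (P-inflationary (suc x)))

    P-mono : P Preserves _≤_ ⟶ _≤_
    P-mono = P-mono′ ∘ ≤⇒≤′
      where
        P-mono′ : ∀ {x y} → x ≤′ y → P x ≤ P y
        P-mono′ ≤′-refl        = ≤-refl
        P-mono′ (≤′-step x≤′y) = ≤-trans (P-mono′ x≤′y) (P-suc _)

    P-≤n : ∀ {x} → x ≤ n → P x ≤ n
    P-≤n x≤n = ≤-trans (P-mono x≤n) (≤-reflexive (P-beyond ≤-refl))

    Path-extend : ∀ {w v d} → v < n → Path c w v d → Path c w (P v) (suc d)
    Path-extend v<n (here _)      = there v<n (here (P-≤n (<⇒≤ v<n)))
    Path-extend v<n (there w<n p) = there w<n (Path-extend v<n p)

    DepthGe-P : ∀ {v d} → v < n → DepthGe c v d → DepthGe c (P v) (suc d)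
    DepthGe-P v<n (w , e , d≤e , p) = w , suc e , s≤s d≤e , Path-extend v<n p

    pdLe⊎pdGt : ∀ k {y l} → y + l ≤ P y → PdLe (at c) y l k ⊎ PdGt y (y + l) k
    pdLe⊎pdGt k {y} {l} y+l≤Py with m≤n⇒m<n∨m≡n (+-cancelˡ-≤ y l (at c y) y+l≤Py)
    pdLe⊎pdGt k       _ | inj₂ l≡cy = inj₁ (proj l≡cy)
    pdLe⊎pdGt zero    {y} _ | inj₁ l<cy = inj₂ (+-monoʳ-< y l<cy)
    pdLe⊎pdGt (suc k) {y} {l} _ | inj₁ l<cy =
      Sum.map (syz l<cy)
              (λ pd → +-monoʳ-< y l<cy , subst (λ z → PdGt (y + l) z k) end pd)
              (pdLe⊎pdGt k (≤-trans (≤-reflexive end) (P-mono (m≤m+n y l))))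
      where
        end : y + l + (at c y ∸ l) ≡ P y
        end = syzygy-end y (<⇒≤ l<cy)

    pdLe⇔¬pdGt-simple : ∀ {i k} → i < n → PdLe (at c) i 1 k ⇔ (¬ PdGt i (suc i) k)
    pdLe⇔¬pdGt-simple {i} {k} i<n = mk⇔
      (λ pd gt → pdGt⇒¬pdLe k (subst (λ z → PdGt i z k) (+-comm 1 i) gt) pd)
      (λ ¬gt → Sum.fromInj₁
                 (λ gt → contradiction (subst (λ z → PdGt i z k) (+-comm i 1) gt) ¬gt)
                 (pdLe⊎pdGt k (+-monoʳ-≤ i (pos i i<n))))

    meet : ∀ fuel {k y z} → n ≤ fuel + y → y < z → z < P y →
           DepthGe c y ⌊ k /2⌋ → DepthGe c z ⌈ k /2⌉ → BadPair c k
    meet zero n≤y y<z z<Py _ _ = contradiction (<P⇒<n (<-trans y<z z<Py)) (≤⇒≯ n≤y)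
    meet (suc fuel) {k} {y} {z} n≤1+fuel+y y<z z<Py dy dz with P y ≟ P z
    ... | yes Py≡Pz = y , z , (y<z , z<n , Py≡Pz) , dy , dz
      where
        z<n : z < n
        z<n = <-≤-trans z<Py (P-≤n (<⇒≤ (<P⇒<n (<-trans y<z z<Py))))
    ... | no Py≢Pz = BadPair-antitone (n≤1+n k)
      (meet fuel n≤fuel+z z<Py (≤∧≢⇒< (P-mono (<⇒≤ y<z)) Py≢Pz) dz
            (DepthGe-P (<P⇒<n (<-trans y<z z<Py)) dy))
      where
        n≤fuel+z : n ≤ fuel + z
        n≤fuel+z =
          ≤-trans n≤1+fuel+y (subst (_≤ fuel + z) (+-suc fuel y) (+-monoʳ-≤ fuel y<z))

    climb : ∀ j {k y z} → PdGt y z j → y < z →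
            DepthGe c y ⌊ k /2⌋ → DepthGe c z ⌈ k /2⌉ → BadPair c (j + k)
    climb zero {y = y} z<Py y<z dy dz = meet n (m≤m+n n y) y<z z<Py dy dz
    climb (suc j) {k} (z<Py , pd) y<z dy dz =
      subst (BadPair c) (+-suc j k)
            (climb j pd z<Py dz (DepthGe-P (<P⇒<n (<-trans y<z z<Py)) dy))

    pdGt⇒badPair : ∀ {i g} → i < n → PdGt i (suc i) g → BadPair c g
    pdGt⇒badPair {i} {g} i<n pd =
      subst (BadPair c) (+-identityʳ g)
            (climb g pd (n<1+n i) (DepthGe-zero (<⇒≤ i<n)) (DepthGe-zero i<n))

    mutual
      pdGt-even : ∀ m {y z} → y ≤ z → z ≤ P y →
                  iterate P y m < iterate P z m → iterate P z m < iterate P y (suc m) →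
                  PdGt y z (m + m)
      pdGt-even zero    _ _ _ z<Py = z<Py
      pdGt-even (suc m) {y} {z} y≤z z≤Py h₁ h₂ =
        subst (PdGt y z) (cong suc (sym (+-suc m m)))
              (z<Py , pdGt-odd m z≤Py (P-mono y≤z) h₁ h₂)
        where
          z<Py : z < P y
          z<Py = ≤∧≢⇒< z≤Py (λ z≡Py → <-irrefl (cong (λ x → iterate P (P x) m) z≡Py) h₂)

      pdGt-odd : ∀ m {y z} → y ≤ z → z ≤ P y →
                 iterate P z m < iterate P y (suc m) →
                 iterate P y (suc m) < iterate P z (suc m) →
                 PdGt y z (suc (m + m))
      pdGt-odd m {y} {z} y≤z z≤Py h₁ h₂ = z<Py , pdGt-even m z≤Py (P-mono y≤z) h₁ h₂
        where
          z<Py : z < P y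
          z<Py = ≤∧≢⇒< z≤Py (λ z≡Py → <-irrefl (cong (λ x → iterate P x m) z≡Py) h₁)

    badPair⇒pdGt-even : ∀ m {u v} → SiblingsLt c u v → DepthGe c u m → DepthGe c v m →
                        ∃[ i ] i < n × PdGt i (suc i) (m + m)
    badPair⇒pdGt-even m {u} {v} (u<v , v<n , Pu≡Pv) du dv
      with descendantAt du | descendantAt dv
    ... | a , Pᵐa≡u | b , Pᵐb≡v =
      straddle (crossing (λ x → iterate P x m) a≤b
                         (subst (_< v) (sym Pᵐa≡u) u<v) (≤-reflexive (sym Pᵐb≡v)))
      where
        a≤b : a ≤ b
        a≤b = <⇒≤ (iterate-cancel-< P-mono m (subst₂ _<_ (sym Pᵐa≡u) (sym Pᵐb≡v) u<v))

        straddle : ∃[ i ] a ≤ i × i < b × iterate P i m < v × v ≤ iterate P (suc i) m →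
                   ∃[ i ] i < n × PdGt i (suc i) (m + m)
        straddle (i , a≤i , i<b , Pᵐi<v , v≤Pᵐ1+i) =
          i , i<n , pdGt-even m (n≤1+n i) (<n⇒<P i<n) (<-≤-trans Pᵐi<v v≤Pᵐ1+i) Pᵐ1+i<Pᵐ⁺¹i
          where
            open ≤-Reasoning

            i<n : i < n
            i<n = begin-strict
              i              <⟨ i<b ⟩
              b              ≤⟨ iterate-inflationary P-inflationary b m ⟩
              iterate P b m  ≡⟨ Pᵐb≡v ⟩
              v              <⟨ v<n ⟩
              n              ∎

            Pᵐ1+i<Pᵐ⁺¹i : iterate P (suc i) m < iterate P i (suc m)
            Pᵐ1+i<Pᵐ⁺¹i = begin-strict
              iterate P (suc i) m  ≤⟨ iterate-mono P-mono m i<b ⟩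
              iterate P b m        ≡⟨ Pᵐb≡v ⟩
              v                    <⟨ <n⇒<P v<n ⟩
              P v                  ≡⟨ sym Pu≡Pv ⟩
              P u                  ≡⟨ cong P (sym Pᵐa≡u) ⟩
              P (iterate P a m)    ≤⟨ P-mono (iterate-mono P-mono m a≤i) ⟩
              P (iterate P i m)    ≡⟨ sym (iterate-suc i m) ⟩
              iterate P i (suc m)  ∎

    badPair⇒pdGt-odd : ∀ m {u v} → SiblingsLt c u v → DepthGe c u m → DepthGe c v (suc m) →
                       ∃[ i ] i < n × PdGt i (suc i) (suc (m + m))
    badPair⇒pdGt-odd m {u} {v} (u<v , v<n , Pu≡Pv) du dv
      with descendantAt du | descendantAt dv
    ... | a , Pᵐa≡u | b , Pᵐ⁺¹b≡v =
      straddle (crossing (λ x → iterate P x (suc m)) b≤a (s≤s (≤-reflexive Pᵐ⁺¹b≡v)) v<Pᵐ⁺¹a)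
      where
        Pᵐ⁺¹a≡Pv : iterate P a (suc m) ≡ P v
        Pᵐ⁺¹a≡Pv = trans (iterate-suc a m) (trans (cong P Pᵐa≡u) Pu≡Pv)

        v<Pᵐ⁺¹a : v < iterate P a (suc m)
        v<Pᵐ⁺¹a = subst (v <_) (sym Pᵐ⁺¹a≡Pv) (<n⇒<P v<n)

        b≤a : b ≤ a
        b≤a = <⇒≤ (iterate-cancel-< P-mono (suc m) (subst (_< _) (sym Pᵐ⁺¹b≡v) v<Pᵐ⁺¹a))

        straddle : ∃[ i ] b ≤ i × i < a × iterate P i (suc m) < suc v ×
                          suc v ≤ iterate P (suc i) (suc m) →
                   ∃[ i ] i < n × PdGt i (suc i) (suc (m + m))
        straddle (i , b≤i , i<a , Pᵐ⁺¹i≤v , v<Pᵐ⁺¹1+i) =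
          i , i<n , pdGt-odd m (n≤1+n i) (<n⇒<P i<n) Pᵐ1+i<Pᵐ⁺¹i
                             (≤-<-trans (≤-pred Pᵐ⁺¹i≤v) v<Pᵐ⁺¹1+i)
          where
            open ≤-Reasoning

            i<n : i < n
            i<n = begin-strict
              i              <⟨ i<a ⟩
              a              ≤⟨ iterate-inflationary P-inflationary a m ⟩
              iterate P a m  ≡⟨ Pᵐa≡u ⟩
              u              <⟨ <-trans u<v v<n ⟩
              n              ∎

            Pᵐ1+i<Pᵐ⁺¹i : iterate P (suc i) m < iterate P i (suc m)
            Pᵐ1+i<Pᵐ⁺¹i = begin-strict
              iterate P (suc i) m  ≤⟨ iterate-mono P-mono m i<a ⟩
              iterate P a m        ≡⟨ Pᵐa≡u ⟩
              u                    <⟨ u<v ⟩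
              v                    ≡⟨ sym Pᵐ⁺¹b≡v ⟩
              iterate P b (suc m)  ≤⟨ iterate-mono P-mono (suc m) b≤i ⟩
              iterate P i (suc m)  ∎

    badPair⇒pdGt : ∀ g → BadPair c g → ∃[ i ] i < n × PdGt i (suc i) g
    badPair⇒pdGt g (u , v , siblings , du , dv) with even⊎odd g
    ... | inj₁ (m , refl) =
      badPair⇒pdGt-even m siblings (DepthGe-≤ (≤-reflexive (n≡⌊n+n/2⌋ m)) du)
                                   (DepthGe-≤ (≤-reflexive (n≡⌈n+n/2⌉ m)) dv)
    ... | inj₂ (m , refl) =
      badPair⇒pdGt-odd m siblings (DepthGe-≤ (≤-reflexive (n≡⌈n+n/2⌉ m)) du)
                                  (DepthGe-≤ (≤-reflexive (cong suc (n≡⌊n+n/2⌋ m))) dv)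

lemma3p8 : (n : ℕ) (c : Vec ℕ n) → IsKupisch c → (g : ℕ) →
    (GldimLe c g ⇔ (¬ BadPair c g))
lemma3p8 n c K g = mk⇔
  (λ gldim bad → let (i , i<n , pd) = badPair⇒pdGt K g bad
                 in Equivalence.to (pdLe⇔¬pdGt-simple K i<n) (gldim i i<n) pd)
  (λ noBad i i<n →
     Equivalence.from (pdLe⇔¬pdGt-simple K i<n) (noBad ∘ pdGt⇒badPair K i<n))
  where open Nakayama c
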